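{- For $n\ge 1$ let $a_n = |S_n^2(132,213,312)|$. Then $a_1=1$ and $a_{n+1} = 2(n+1)$ for all $n\ge 1$.
   Context: A $3$-permutation of size $n$ is an ordered pair $(\sigma,\sigma')$ of permutations of $[n]=\{1,\dots,n\}$. A (classical) permutation $\tau\in S_n$ contains a pattern $\pi\in S_k$ if there are indices $c_1<\dots<c_k$ such that $\tau(c_1)\cdots\tau(c_k)$ is order-isomorphic to $\pi$, and avoids $\pi$ otherwise. A $3$-permutation $(\sigma,\sigma')$ avoids a pattern $\pi\in S_k$ if each of the three permutations $\sigma$, $\sigma'$, and $\sigma'\circ\sigma^{ -1}$ (where $(\sigma'\circ\sigma^{ -1})(i)=\sigma'(\sigma^{ -1}(i))$) avoids $\pi$. $S_n^2(\pi_1,\dots,\pi_m)$ denotes the set of $3$-permutations of size $n$ avoiding each of $\pi_1,\dots,\pi_m$. Patterns are written in one-line notation. -}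

module Defs where

open import Data.Nat using (ℕ; zero; suc)
open import Data.Fin using (Fin; _<_; #_)
open import Data.Fin.Permutation using (Permutation′; _⟨$⟩ʳ_; _⟨$⟩ˡ_)
open import Data.Product using (Σ; _×_; ∃)
open import Data.List using (List; length)
open import Data.List.Relation.Unary.All using (All)
open import Data.List.Relation.Unary.Any using (Any)
open import Data.List.Relation.Unary.AllPairs using (AllPairs)
open import Data.Vec using (Vec; []; _∷_; lookup)
open import Function.Bundles using (_⇔_)
open import Relation.Nullary using (¬_)
open import Relation.Binary.PropositionalEquality using (_≡_)

Contains : {n k : ℕ} → (Fin n → Fin n) → (Fin k → Fin k) → Set
Contains {n} {k} τ π =
  Σ (Fin k → Fin n) λ c →
    (∀ i j → i < j → c i < c j) ×
    (∀ i j → (τ (c i) < τ (c j)) ⇔ (π i < π j))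

Avoids : {n k : ℕ} → (Fin n → Fin n) → (Fin k → Fin k) → Set
Avoids τ π = ¬ Contains τ π

-- patterns in one-line notation (values shifted to 0-based Fin 3)
pattern132 pattern213 pattern312 : Fin 3 → Fin 3
pattern132 = lookup (# 0 ∷ # 2 ∷ # 1 ∷ [])
pattern213 = lookup (# 1 ∷ # 0 ∷ # 2 ∷ [])
pattern312 = lookup (# 2 ∷ # 0 ∷ # 1 ∷ [])

ThreePerm : ℕ → Set
ThreePerm n = Permutation′ n × Permutation′ n

ThreeAvoids : {n k : ℕ} → ThreePerm n → (Fin k → Fin k) → Set
ThreeAvoids (σ Data.Product., σ') π =
  Avoids (σ ⟨$⟩ʳ_) π × Avoids (σ' ⟨$⟩ʳ_) π × Avoids (λ i → σ' ⟨$⟩ʳ (σ ⟨$⟩ˡ i)) π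

InS2-132-213-312 : (n : ℕ) → ThreePerm n → Set
InS2-132-213-312 n s =
  ThreeAvoids s pattern132 × ThreeAvoids s pattern213 × ThreeAvoids s pattern312

_≈₃_ : {n : ℕ} → ThreePerm n → ThreePerm n → Set
(σ Data.Product., σ') ≈₃ (ρ Data.Product., ρ') =
  (∀ i → σ ⟨$⟩ʳ i ≡ ρ ⟨$⟩ʳ i) × (∀ i → σ' ⟨$⟩ʳ i ≡ ρ' ⟨$⟩ʳ i)

HasCard : {n : ℕ} → (ThreePerm n → Set) → ℕ → Set
HasCard {n} P m =
  Σ (List (ThreePerm n)) λ L →
    (length L ≡ m) ×
    AllPairs (λ x y → ¬ (x ≈₃ y)) L ×
    All P L ×
    (∀ s → P s → Any (λ t → s ≈₃ t) L)

-- A permutation avoids 213 and 312 exactly when no entry is smaller than both some entry to its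
-- left and some entry to its right (no valley).  If it also avoids 132 and k is its first entry,
-- the positions carrying entries above k form an increasing initial run and those carrying entries
-- below k a decreasing final run.  A strictly monotone run of d steps passes through at least d
-- values; as there are m − 1 − k values above k and k below it, the permutation is the tent
-- k, k+1, …, m−1, k−1, …, 1, 0.  So (σ, σ′) lies in S²ₘ(132, 213, 312) iff σ = τₐ, σ′ = τ_b and
-- τ_b ∘ τₐ⁻¹ = τ_c for some tents.  Evaluating τ_c ∘ τₐ = τ_b at the first and at the last position
-- leaves a = 0, or a = b, or (a, b) = (m−1, 0), and all these pairs occur: 2m of them when m ≥ 2.

module Submission where

open import Defs
open import Data.Nat using (ℕ; zero; suc; _+_; _∸_; _*_; _≤_; _<_; z≤n; s≤s; s≤s⁻¹; z<s; s<s; _<?_)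
open import Data.Nat.Properties
open import Data.Nat.Tactic.RingSolver using (solve-∀)
open import Data.Product using (Σ; _×_; _,_; proj₁; proj₂)
open import Data.Fin as Fin using (Fin; zero; suc; toℕ; fromℕ; fromℕ<; #_; opposite)
open import Data.Fin.Properties as Finₚ
  using (toℕ<n; toℕ-injective; toℕ-fromℕ<; toℕ-fromℕ; fromℕ<-toℕ; opposite-prop; opposite-involutive)
open import Data.Fin.Permutation
  using (Permutation′; permutation; _⟨$⟩ʳ_; _⟨$⟩ˡ_; inverseˡ; inverseʳ; _≈_; id; flip; _∘ₚ_; reverse)
open import Data.Vec using ([]; _∷_; lookup)
open import Data.Empty using (⊥; ⊥-elim)
open import Data.Sum using (_⊎_; inj₁; inj₂)
open import Data.List using (List; []; _∷_; _++_; tabulate; length; map)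
open import Data.List.Properties using (length-++; length-tabulate; length-map)
open import Data.List.Relation.Unary.All using (All; []; _∷_)
import Data.List.Relation.Unary.All.Properties as Allₚ
open import Data.List.Relation.Unary.Any as Any using (here)
import Data.List.Relation.Unary.Any.Properties as Anyₚ
open import Data.List.Relation.Unary.AllPairs as AllPairs using (AllPairs; []; _∷_)
import Data.List.Relation.Unary.AllPairs.Properties as AllPairsₚ
open import Data.List.Membership.Propositional using (_∈_)
open import Data.List.Membership.Propositional.Properties using (∈-tabulate⁺; ∈-++⁺ˡ; ∈-++⁺ʳ)
open import Function using (_∘_; Injective)
open import Function.Bundles using (_⇔_; mk⇔; Equivalence; Inverse; Injection)
open import Function.Properties.Inverse using (↔⇒↣)
open import Relation.Binary.Definitions using (Tri; tri<; tri≈; tri>)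
open import Relation.Binary.PropositionalEquality
open import Relation.Nullary using (yes; no)
open import Relation.Nullary.Negation using (contradiction)

-- Tents

-- tent m k lists k, k+1, …, m−1 and then k−1, …, 1, 0.
tent : ℕ → ℕ → ℕ → ℕ
tent m k i with k + i <? m
... | yes _ = k + i
... | no  _ = m ∸ suc i

tent⁻¹ : ℕ → ℕ → ℕ → ℕ
tent⁻¹ m k v with v <? k
... | yes _ = m ∸ suc v
... | no  _ = v ∸ k

m∸[1+n]<m : ∀ {m n} → n < m → m ∸ suc n < m
m∸[1+n]<m {suc m} {n} _ = s≤s (m∸n≤m m n)

m∸[1+[m∸[1+n]]]≡n : ∀ {m n} → n < m → m ∸ suc (m ∸ suc n) ≡ n
m∸[1+[m∸[1+n]]]≡n {suc m} (s≤s n≤m) = m∸[m∸n]≡n n≤m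

m≤k+i⇒m∸[1+i]<k : ∀ {m k i} → m ≤ k + i → i < m → m ∸ suc i < k
m≤k+i⇒m∸[1+i]<k {m} {k} {i} m≤k+i i<m =
  subst (m ∸ suc i <_) (m+n∸n≡m k i) (∸-monoˡ-< (s≤s m≤k+i) i<m)

tent-rising : ∀ {m k i} → k + i < m → tent m k i ≡ k + i
tent-rising {m} {k} {i} k+i<m with k + i <? m
... | yes _      = refl
... | no  k+i≮m = contradiction k+i<m k+i≮m

tent-falling : ∀ {m k i} → m ≤ k + i → tent m k i ≡ m ∸ suc i
tent-falling {m} {k} {i} m≤k+i with k + i <? m
... | yes k+i<m = contradiction m≤k+i (<⇒≱ k+i<m)
... | no  _     = refl

tent< : ∀ {m k i} → i < m → tent m k i < m
tent< {m} {k} {i} i<m with k + i <? m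
... | yes k+i<m = k+i<m
... | no  _     = m∸[1+n]<m i<m

tent⁻¹< : ∀ {m k v} → v < m → tent⁻¹ m k v < m
tent⁻¹< {m} {k} {v} v<m with v <? k
... | yes _ = m∸[1+n]<m v<m
... | no  _ = ≤-<-trans (m∸n≤m v k) v<m

tent⁻¹-tent : ∀ {m k i} → i < m → tent⁻¹ m k (tent m k i) ≡ i
tent⁻¹-tent {m} {k} {i} i<m with k + i <? m
... | yes _ with k + i <? k
...   | yes k+i<k = contradiction (m≤m+n k i) (<⇒≱ k+i<k)
...   | no  _     = m+n∸m≡n k i
tent⁻¹-tent {m} {k} {i} i<m | no k+i≮m with m ∸ suc i <? k
...   | yes _          = m∸[1+[m∸[1+n]]]≡n i<m
...   | no  m∸[1+i]≮k = contradiction (m≤k+i⇒m∸[1+i]<k (≮⇒≥ k+i≮m) i<m) m∸[1+i]≮k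

tent-tent⁻¹ : ∀ {m k v} → v < m → tent m k (tent⁻¹ m k v) ≡ v
tent-tent⁻¹ {m} {k} {v} v<m with v <? k
... | yes v<k = trans (tent-falling m≤k+j) (m∸[1+[m∸[1+n]]]≡n v<m)
  where
  m≤k+j : m ≤ k + (m ∸ suc v)
  m≤k+j = begin
    m                   ≡⟨ m+[n∸m]≡n v<m ⟨
    suc v + (m ∸ suc v) ≤⟨ +-monoˡ-≤ (m ∸ suc v) v<k ⟩
    k + (m ∸ suc v)     ∎
    where open ≤-Reasoning
... | no v≮k = trans (tent-rising (subst (_< m) (sym k+[v∸k]≡v) v<m)) k+[v∸k]≡v
  where
  k+[v∸k]≡v : k + (v ∸ k) ≡ v
  k+[v∸k]≡v = m+[n∸m]≡n (≮⇒≥ v≮k)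

tent-increasing : ∀ {m k i j} → i < j → k + j < m → tent m k i < tent m k j
tent-increasing {k = k} i<j k+j<m =
  subst₂ _<_ (sym (tent-rising (<-trans (+-monoʳ-< k i<j) k+j<m))) (sym (tent-rising k+j<m))
    (+-monoʳ-< k i<j)

tent-decreasing : ∀ {m k i j} → i < j → j < m → m ≤ k + j → tent m k j < tent m k i
tent-decreasing {m} {k} {i} {j} i<j j<m m≤k+j with <-≤-connex (k + i) m
... | inj₁ k+i<m = subst₂ _<_ (sym (tent-falling {k = k} m≤k+j)) (sym (tent-rising k+i<m))
  (≤-trans (m≤k+i⇒m∸[1+i]<k m≤k+j j<m) (m≤m+n k i))
... | inj₂ m≤k+i = subst₂ _<_ (sym (tent-falling {k = k} m≤k+j)) (sym (tent-falling {k = k} m≤k+i))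
  (∸-monoʳ-< (s≤s i<j) j<m)

tent-at-0 : ∀ {m k} → k < m → tent m k 0 ≡ k
tent-at-0 {k = k} k<m =
  trans (tent-rising {k = k} {i = 0} (subst (_< _) (sym (+-identityʳ k)) k<m)) (+-identityʳ k)

tent-0-id : ∀ {m i} → i < m → tent m 0 i ≡ i
tent-0-id {i = i} i<m = tent-rising {k = 0} {i = i} i<m

tent-at-last : ∀ {n k} → 0 < k → tent (suc n) k n ≡ 0
tent-at-last {n} {k} 0<k = trans (tent-falling {k = k} {i = n} (+-monoˡ-≤ n 0<k)) (n∸n≡0 n)

tent-reverse : ∀ n i → tent (suc n) n i ≡ n ∸ i
tent-reverse n zero    =
  trans (tent-rising {k = n} {i = 0} (subst (_< suc n) (sym (+-identityʳ n)) (n<1+n n))) (+-identityʳ n)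
tent-reverse n (suc i) =
  tent-falling {k = n} {i = suc i} (subst (suc n ≤_) (sym (+-suc n i)) (s≤s (m≤m+n n i)))

-- A valley is an occurrence of 213 or of 312.
NoValleyOn : ℕ → (ℕ → ℕ) → Set
NoValleyOn m h = ∀ {a b c} → a < b → b < c → c < m → h b < h a → h b < h c → ⊥

No132On : ℕ → (ℕ → ℕ) → Set
No132On m h = ∀ {a b c} → a < b → b < c → c < m → h a < h c → h c < h b → ⊥

tent-noValley : ∀ {m k} → NoValleyOn m (tent m k)
tent-noValley {m} {k} {b = b} a<b b<c c<m hb<ha hb<hc with <-≤-connex (k + b) m
... | inj₁ k+b<m = <-asym hb<ha (tent-increasing a<b k+b<m)
... | inj₂ m≤k+b = <-asym hb<hc
  (tent-decreasing b<c c<m (≤-trans m≤k+b (+-monoʳ-≤ k (<⇒≤ b<c))))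

tent-no132 : ∀ {m k} → No132On m (tent m k)
tent-no132 {m} {k} {c = c} a<b b<c c<m ha<hc hc<hb with <-≤-connex (k + c) m
... | inj₁ k+c<m = <-asym hc<hb (tent-increasing b<c k+c<m)
... | inj₂ m≤k+c = <-asym ha<hc (tent-decreasing (<-trans a<b b<c) c<m m≤k+c)

-- Valley- and 132-free sequences are tents

ascent⇒g[0]+n≤g[n] : ∀ {g : ℕ → ℕ} n → (∀ {d} → d < n → g d < g (suc d)) → g 0 + n ≤ g n
ascent⇒g[0]+n≤g[n] {g} zero    _    = ≤-reflexive (+-identityʳ (g 0))
ascent⇒g[0]+n≤g[n] {g} (suc n) step = begin
  g 0 + suc n   ≡⟨ +-suc (g 0) n ⟩
  suc (g 0 + n) ≤⟨ s≤s (ascent⇒g[0]+n≤g[n] n (step ∘ m<n⇒m<1+n)) ⟩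
  suc (g n)     ≤⟨ step (n<1+n n) ⟩
  g (suc n)     ∎
  where open ≤-Reasoning

descent⇒g[n]+n≤g[0] : ∀ {g : ℕ → ℕ} n → (∀ {d} → d < n → g (suc d) < g d) → g n + n ≤ g 0
descent⇒g[n]+n≤g[0] {g} zero    _    = ≤-reflexive (+-identityʳ (g 0))
descent⇒g[n]+n≤g[0] {g} (suc n) step = begin
  g (suc n) + suc n   ≡⟨ +-suc (g (suc n)) n ⟩
  suc (g (suc n) + n) ≤⟨ +-monoˡ-< n (step (n<1+n n)) ⟩
  g n + n             ≤⟨ descent⇒g[n]+n≤g[0] n (step ∘ m<n⇒m<1+n) ⟩
  g 0                 ∎
  where open ≤-Reasoning

1+d+[1+k+i]≡1+k+[1+d+i] : ∀ d k i → suc d + suc (k + i) ≡ suc (k + suc (d + i))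
1+d+[1+k+i]≡1+k+[1+d+i] = solve-∀

module ValleyAnd132Free {m : ℕ} {h : ℕ → ℕ}
  (bounded : ∀ {i} → i < m → h i < m)
  (injective : ∀ {i j} → i < m → j < m → h i ≡ h j → i ≡ j)
  (noValley : NoValleyOn m h)
  (no132 : No132On m h)
  where

  -- high / low: above / below the first value h 0

  distinct : ∀ {i j} → i < j → j < m → h i ≢ h j
  distinct i<j j<m eq = <-irrefl (injective (<-trans i<j j<m) j<m eq) i<j

  high⇒earlier-high : ∀ {i j} → 0 < i → i < j → j < m → h 0 < h j → h 0 < h i
  high⇒earlier-high {i} 0<i i<j j<m h0<hj with <-cmp (h 0) (h i)
  ... | tri< h0<hi _ _ = h0<hi
  ... | tri≈ _ h0≡hi _ = ⊥-elim (distinct 0<i (<-trans i<j j<m) h0≡hi)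
  ... | tri> _ _ hi<h0 = ⊥-elim (noValley 0<i i<j j<m hi<h0 (<-trans hi<h0 h0<hj))

  high⇒earlier-lower : ∀ {i j} → 0 < i → i < j → j < m → h 0 < h j → h i < h j
  high⇒earlier-lower {i} {j} 0<i i<j j<m h0<hj with <-cmp (h i) (h j)
  ... | tri< hi<hj _ _ = hi<hj
  ... | tri≈ _ hi≡hj _ = ⊥-elim (distinct i<j j<m hi≡hj)
  ... | tri> _ _ hj<hi = ⊥-elim (no132 0<i i<j j<m h0<hj hj<hi)

  low⇒later-lower : ∀ {i j} → 0 < i → i < j → j < m → h i < h 0 → h j < h i
  low⇒later-lower {i} {j} 0<i i<j j<m hi<h0 with <-cmp (h j) (h i)
  ... | tri< hj<hi _ _ = hj<hi
  ... | tri≈ _ hj≡hi _ = ⊥-elim (distinct i<j j<m (sym hj≡hi))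
  ... | tri> _ _ hi<hj = ⊥-elim (noValley 0<i i<j j<m hi<h0 hi<hj)

  high-before : ∀ {i j} → 0 < i → i ≤ j → j < m → h 0 < h j → h 0 < h i
  high-before 0<i i≤j j<m h0<hj with m≤n⇒m<n∨m≡n i≤j
  ... | inj₁ i<j  = high⇒earlier-high 0<i i<j j<m h0<hj
  ... | inj₂ refl = h0<hj

  low-after : ∀ {i j} → 0 < i → i ≤ j → j < m → h i < h 0 → h j < h 0
  low-after 0<i i≤j j<m hi<h0 with m≤n⇒m<n∨m≡n i≤j
  ... | inj₁ i<j  = <-trans (low⇒later-lower 0<i i<j j<m hi<h0) hi<h0
  ... | inj₂ refl = hi<h0

  low⇒0<i : ∀ {i} → h i < h 0 → 0 < i
  low⇒0<i {zero}  hi<h0 = ⊥-elim (<-irrefl refl hi<h0)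
  low⇒0<i {suc _} _     = z<s

  falling⇒0<i : ∀ {i} → m ≤ h 0 + i → i < m → 0 < i
  falling⇒0<i {zero}  m≤h0+0 0<m =
    ⊥-elim (<⇒≱ (bounded 0<m) (subst (m ≤_) (+-identityʳ (h 0)) m≤h0+0))
  falling⇒0<i {suc _} _      _   = z<s

  high⇒h0+i≤h : ∀ {i} → 0 < i → i < m → h 0 < h i → h 0 + i ≤ h i
  high⇒h0+i≤h {i} 0<i i<m h0<hi = ascent⇒g[0]+n≤g[n] i step
    where
    step : ∀ {d} → d < i → h d < h (suc d)
    step {zero}  d<i = high-before z<s d<i i<m h0<hi
    step {suc d} d<i = high⇒earlier-lower z<s (n<1+n (suc d)) (≤-<-trans d<i i<m)
      (high-before z<s d<i i<m h0<hi)

  low⇒m∸[1+i]≤h : ∀ {i} → i < m → h i < h 0 → m ∸ suc i ≤ h i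
  low⇒m∸[1+i]≤h {i} i<m hi<h0 =
    m+n≤o⇒n≤o (h (n + i)) (descent⇒g[n]+n≤g[0] {λ d → h (d + i)} n step)
    where
    n = m ∸ suc i
    0<i = low⇒0<i hi<h0
    step : ∀ {d} → d < n → h (suc d + i) < h (d + i)
    step {d} d<n = low⇒later-lower (≤-trans 0<i (m≤n+m i d)) (n<1+n (d + i)) sd+i<m
      (low-after 0<i (m≤n+m i d) (<-trans (n<1+n (d + i)) sd+i<m) hi<h0)
      where
      sd+i<m : suc d + i < m
      sd+i<m = subst (_≤ m) (+-suc (suc d) i) (m≤o∸n⇒m+n≤o (suc d) i<m d<n)

  low⇒m≤h0+i : ∀ {i} → i < m → h i < h 0 → m ≤ h 0 + i
  low⇒m≤h0+i {i} i<m hi<h0 = begin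
    m                       ≡⟨ m∸n+n≡m i<m ⟨
    (m ∸ suc i) + suc i     ≡⟨ +-suc (m ∸ suc i) i ⟩
    suc (m ∸ suc i) + i     ≤⟨ +-monoˡ-≤ i (≤-<-trans (low⇒m∸[1+i]≤h i<m hi<h0) hi<h0) ⟩
    h 0 + i                 ∎
    where open ≤-Reasoning

  rising⇒i<m : ∀ {i} → h 0 + i < m → i < m
  rising⇒i<m {i} = ≤-<-trans (m≤n+m i (h 0))

  rising⇒high : ∀ {i} → 0 < i → h 0 + i < m → h 0 < h i
  rising⇒high {i} 0<i h0+i<m with <-cmp (h 0) (h i)
  ... | tri< h0<hi _ _ = h0<hi
  ... | tri≈ _ h0≡hi _ = ⊥-elim (distinct 0<i (rising⇒i<m h0+i<m) h0≡hi)
  ... | tri> _ _ hi<h0 = ⊥-elim (<⇒≱ h0+i<m (low⇒m≤h0+i (rising⇒i<m h0+i<m) hi<h0))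

  falling⇒low : ∀ {i} → m ≤ h 0 + i → i < m → h i < h 0
  falling⇒low {i} m≤h0+i i<m with <-cmp (h i) (h 0)
  ... | tri< hi<h0 _ _ = hi<h0
  ... | tri≈ _ hi≡h0 _ = ⊥-elim (distinct (falling⇒0<i m≤h0+i i<m) i<m (sym hi≡h0))
  ... | tri> _ _ h0<hi = ⊥-elim (<⇒≱ (≤-<-trans (high⇒h0+i≤h 0<i i<m h0<hi) (bounded i<m)) m≤h0+i)
    where 0<i = falling⇒0<i m≤h0+i i<m

  rising-step : ∀ {j} → h 0 + suc j < m → h j < h (suc j)
  rising-step {zero}  h0+1<m   = rising⇒high z<s h0+1<m
  rising-step {suc j} h0+ssj<m = high⇒earlier-lower z<s (n<1+n (suc j))
    (rising⇒i<m h0+ssj<m) (rising⇒high z<s h0+ssj<m)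

  falling-step : ∀ {j} → m ≤ h 0 + j → suc j < m → h (suc j) < h j
  falling-step {j} m≤h0+j sj<m = low⇒later-lower (falling⇒0<i m≤h0+j j<m) (n<1+n j) sj<m
    (falling⇒low m≤h0+j j<m)
    where j<m = <-trans (n<1+n j) sj<m

  rising⇒h≡h0+i : ∀ {i} → h 0 + i < m → h i ≡ h 0 + i
  rising⇒h≡h0+i {zero}      _     = sym (+-identityʳ (h 0))
  rising⇒h≡h0+i {i@(suc _)} k+i<m = ≤-antisym upper lower
    where
    k = h 0
    n = m ∸ suc (k + i)
    1+k+i+n≡m : suc (k + i) + n ≡ m
    1+k+i+n≡m = trans (+-comm (suc (k + i)) n) (m∸n+n≡m k+i<m)
    lower : k + i ≤ h i
    lower = high⇒h0+i≤h z<s (rising⇒i<m k+i<m) (rising⇒high z<s k+i<m)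
    -- ascend from i to the last rising position m − k − 1, whose value is below m
    step : ∀ {d} → d < n → h (d + i) < h (suc d + i)
    step {d} d<n =
      rising-step (subst (_≤ m) (1+d+[1+k+i]≡1+k+[1+d+i] d k i) (m≤o∸n⇒m+n≤o (suc d) k+i<m d<n))
    n+i<m : n + i < m
    n+i<m = begin-strict
      n + i           ≤⟨ +-monoʳ-≤ n (m≤n+m i k) ⟩
      n + (k + i)     <⟨ +-monoʳ-< n (n<1+n (k + i)) ⟩
      n + suc (k + i) ≡⟨ +-comm n (suc (k + i)) ⟩
      suc (k + i) + n ≡⟨ 1+k+i+n≡m ⟩
      m               ∎
      where open ≤-Reasoning
    upper : h i ≤ k + i
    upper = s≤s⁻¹ (+-cancelʳ-< n (h i) (suc (k + i)) (begin-strict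
      h i + n         ≤⟨ ascent⇒g[0]+n≤g[n] {λ d → h (d + i)} n step ⟩
      h (n + i)       <⟨ bounded n+i<m ⟩
      m               ≡⟨ 1+k+i+n≡m ⟨
      suc (k + i) + n ∎))
      where open ≤-Reasoning

  falling⇒h≡m∸[1+i] : ∀ {i} → m ≤ h 0 + i → i < m → h i ≡ m ∸ suc i
  falling⇒h≡m∸[1+i] {i} m≤h0+i i<m =
    ≤-antisym upper (low⇒m∸[1+i]≤h i<m (falling⇒low m≤h0+i i<m))
    where
    k = h 0
    p = m ∸ k
    e = i ∸ p
    k+p≡m : k + p ≡ m
    k+p≡m = m+[n∸m]≡n (<⇒≤ (bounded (≤-<-trans z≤n i<m)))
    p≤i : p ≤ i
    p≤i = m≤n+o⇒m∸n≤o m k m≤h0+i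
    e+p≡i : e + p ≡ i
    e+p≡i = m∸n+n≡m p≤i
    -- descend to i from the first falling position p, whose value is below k
    step : ∀ {d} → d < e → h (suc d + p) < h (d + p)
    step {d} d<e = falling-step (subst (_≤ k + (d + p)) k+p≡m (+-monoʳ-≤ k (m≤n+m p d)))
      (≤-<-trans (subst (suc d + p ≤_) e+p≡i (+-monoˡ-≤ p d<e)) i<m)
    hi+e<k : h i + e < k
    hi+e<k = subst (λ j → h j + e < k) e+p≡i
      (≤-<-trans (descent⇒g[n]+n≤g[0] {λ d → h (d + p)} e step)
                 (falling⇒low (≤-reflexive (sym k+p≡m)) (≤-<-trans p≤i i<m)))
    upper : h i ≤ m ∸ suc i
    upper = m+n≤o⇒m≤o∸n (h i) (begin
      h i + suc i         ≡⟨ cong (λ j → h i + suc j) e+p≡i ⟨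
      h i + suc (e + p)   ≡⟨ +-suc (h i) (e + p) ⟩
      suc (h i + (e + p)) ≡⟨ cong suc (+-assoc (h i) e p) ⟨
      suc (h i + e) + p   ≤⟨ +-monoˡ-≤ p hi+e<k ⟩
      k + p               ≡⟨ k+p≡m ⟩
      m                   ∎)
      where open ≤-Reasoning

  h≡tent : ∀ {i} → i < m → h i ≡ tent m (h 0) i
  h≡tent {i} i<m with <-≤-connex (h 0 + i) m
  ... | inj₁ h0+i<m = trans (rising⇒h≡h0+i h0+i<m) (sym (tent-rising h0+i<m))
  ... | inj₂ m≤h0+i = trans (falling⇒h≡m∸[1+i] m≤h0+i i<m) (sym (tent-falling m≤h0+i))

-- Patterns of length three

increasing₃ : ∀ {m} {w : Fin 3 → Fin m} → w (# 0) Fin.< w (# 1) → w (# 1) Fin.< w (# 2) →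
              ∀ {i j} → i Fin.< j → w i Fin.< w j
increasing₃ w₀<w₁ w₁<w₂ {zero}          {suc zero}       _ = w₀<w₁
increasing₃ w₀<w₁ w₁<w₂ {zero}          {suc (suc zero)} _ = Finₚ.<-trans w₀<w₁ w₁<w₂
increasing₃ w₀<w₁ w₁<w₂ {suc zero}      {suc (suc zero)} _ = w₁<w₂
increasing₃ _ _ {zero}          {zero}           ()
increasing₃ _ _ {suc zero}      {zero}           ()
increasing₃ _ _ {suc zero}      {suc zero}       (s≤s ())
increasing₃ _ _ {suc (suc zero)} {zero}          ()
increasing₃ _ _ {suc (suc zero)} {suc zero}      (s≤s ())
increasing₃ _ _ {suc (suc zero)} {suc (suc zero)} (s≤s (s≤s ()))

module _ {m} (f : Fin m → Fin m) (π : Permutation′ 3) where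

  -- c lists the positions of an occurrence from left to right; read in the order π⁻¹,
  -- their values increase
  Chain : (Fin 3 → Fin m) → Set
  Chain c = c (# 0) Fin.< c (# 1) × c (# 1) Fin.< c (# 2) ×
            f (c (π ⟨$⟩ˡ # 0)) Fin.< f (c (π ⟨$⟩ˡ # 1)) × f (c (π ⟨$⟩ˡ # 1)) Fin.< f (c (π ⟨$⟩ˡ # 2))

  contains⇒chain : Contains f (π ⟨$⟩ʳ_) → Σ (Fin 3 → Fin m) Chain
  contains⇒chain (c , c↑ , iso) = c , c↑ _ _ z<s , c↑ _ _ (s<s z<s) , ordered z<s , ordered (s<s z<s)
    where
    ordered : ∀ {a b} → a Fin.< b → f (c (π ⟨$⟩ˡ a)) Fin.< f (c (π ⟨$⟩ˡ b))
    ordered a<b = Equivalence.from (iso _ _) (subst₂ Fin._<_ (sym (inverseʳ π)) (sym (inverseʳ π)) a<b)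

  chain⇒contains : ∀ c → Chain c → Contains f (π ⟨$⟩ʳ_)
  chain⇒contains c (c₀<c₁ , c₁<c₂ , v₀<v₁ , v₁<v₂) =
    c , (λ _ _ → increasing₃ c₀<c₁ c₁<c₂) , λ i j → mk⇔ (reflect i j) (preserve i j)
    where
    preserve : ∀ i j → π ⟨$⟩ʳ i Fin.< π ⟨$⟩ʳ j → f (c i) Fin.< f (c j)
    preserve i j πi<πj = subst₂ (λ a b → f (c a) Fin.< f (c b)) (inverseˡ π) (inverseˡ π)
      (increasing₃ {w = λ a → f (c (π ⟨$⟩ˡ a))} v₀<v₁ v₁<v₂ πi<πj)
    reflect : ∀ i j → f (c i) Fin.< f (c j) → π ⟨$⟩ʳ i Fin.< π ⟨$⟩ʳ j
    reflect i j fci<fcj with Finₚ.<-cmp (π ⟨$⟩ʳ i) (π ⟨$⟩ʳ j)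
    ... | tri< πi<πj _ _ = πi<πj
    ... | tri≈ _ πi≡πj _ =
      ⊥-elim (Finₚ.<-irrefl (cong (f ∘ c) (Injection.injective (↔⇒↣ π) πi≡πj)) fci<fcj)
    ... | tri> _ _ πj<πi = ⊥-elim (Finₚ.<-asym fci<fcj (preserve j i πj<πi))

≗-on-Fin3 : ∀ {A : Set} {f g : Fin 3 → A} →
            f (# 0) ≡ g (# 0) → f (# 1) ≡ g (# 1) → f (# 2) ≡ g (# 2) → f ≗ g
≗-on-Fin3 f₀≡g₀ _     _     zero             = f₀≡g₀
≗-on-Fin3 _     f₁≡g₁ _     (suc zero)       = f₁≡g₁
≗-on-Fin3 _     _     f₂≡g₂ (suc (suc zero)) = f₂≡g₂

pattern132ᵖ pattern213ᵖ pattern312ᵖ : Permutation′ 3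
pattern132ᵖ = permutation pattern132 pattern132 (≗-on-Fin3 refl refl refl) (≗-on-Fin3 refl refl refl)
pattern213ᵖ = permutation pattern213 pattern213 (≗-on-Fin3 refl refl refl) (≗-on-Fin3 refl refl refl)
pattern312ᵖ =
  permutation pattern312 (lookup (# 1 ∷ # 2 ∷ # 0 ∷ [])) (≗-on-Fin3 refl refl refl) (≗-on-Fin3 refl refl refl)

-- Permutations avoiding 132, 213 and 312

tentPerm : ∀ {m} → Fin m → Permutation′ m
tentPerm {m} k = permutation to from to∘from from∘to
  where
  K = toℕ k
  to from : Fin m → Fin m
  to   i = fromℕ< (tent<  {k = K} (toℕ<n i))
  from v = fromℕ< (tent⁻¹< {k = K} (toℕ<n v))
  to∘from : ∀ v → to (from v) ≡ v
  to∘from v = toℕ-injective (begin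
    toℕ (to (from v))              ≡⟨ toℕ-fromℕ< _ ⟩
    tent m K (toℕ (from v))        ≡⟨ cong (tent m K) (toℕ-fromℕ< _) ⟩
    tent m K (tent⁻¹ m K (toℕ v))  ≡⟨ tent-tent⁻¹ {k = K} (toℕ<n v) ⟩
    toℕ v                          ∎)
    where open ≡-Reasoning
  from∘to : ∀ i → from (to i) ≡ i
  from∘to i = toℕ-injective (begin
    toℕ (from (to i))              ≡⟨ toℕ-fromℕ< _ ⟩
    tent⁻¹ m K (toℕ (to i))        ≡⟨ cong (tent⁻¹ m K) (toℕ-fromℕ< _) ⟩
    tent⁻¹ m K (tent m K (toℕ i))  ≡⟨ tent⁻¹-tent {k = K} (toℕ<n i) ⟩
    toℕ i                          ∎)
    where open ≡-Reasoning

toℕ-tentPerm : ∀ {m} (k i : Fin m) → toℕ (tentPerm k ⟨$⟩ʳ i) ≡ tent m (toℕ k) (toℕ i)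
toℕ-tentPerm k i = toℕ-fromℕ< _

AvoidsAll : ∀ {m} → (Fin m → Fin m) → Set
AvoidsAll f = Avoids f pattern132 × Avoids f pattern213 × Avoids f pattern312

module Tracked {m} {f : Fin m → Fin m} {h : ℕ → ℕ} (tracks : ∀ i → toℕ (f i) ≡ h (toℕ i)) where

  private
    <⇒h< : ∀ {i j} → f i Fin.< f j → h (toℕ i) < h (toℕ j)
    <⇒h< = subst₂ _<_ (tracks _) (tracks _)

    h-fromℕ< : ∀ {a} (a<m : a < m) → toℕ (f (fromℕ< a<m)) ≡ h a
    h-fromℕ< a<m = trans (tracks _) (cong h (toℕ-fromℕ< a<m))

    fromℕ<-mono : ∀ {a b} (a<m : a < m) (b<m : b < m) → a < b → fromℕ< a<m Fin.< fromℕ< b<m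
    fromℕ<-mono a<m b<m = subst₂ _<_ (sym (toℕ-fromℕ< a<m)) (sym (toℕ-fromℕ< b<m))

    h<⇒< : ∀ {a b} (a<m : a < m) (b<m : b < m) → h a < h b → f (fromℕ< a<m) Fin.< f (fromℕ< b<m)
    h<⇒< a<m b<m = subst₂ _<_ (sym (h-fromℕ< a<m)) (sym (h-fromℕ< b<m))

    positions : ∀ {a b c} → a < m → b < m → c < m → Fin 3 → Fin m
    positions a<m b<m c<m = lookup (fromℕ< a<m ∷ fromℕ< b<m ∷ fromℕ< c<m ∷ [])

  tracked-bounded : ∀ {a} → a < m → h a < m
  tracked-bounded a<m = subst (_< m) (h-fromℕ< a<m) (toℕ<n _)

  tracked-injective : Injective _≡_ _≡_ f → ∀ {a b} → a < m → b < m → h a ≡ h b → a ≡ b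
  tracked-injective f-inj {a} {b} a<m b<m ha≡hb = begin
    a                ≡⟨ toℕ-fromℕ< a<m ⟨
    toℕ (fromℕ< a<m) ≡⟨ cong toℕ (f-inj (toℕ-injective f-a≡f-b)) ⟩
    toℕ (fromℕ< b<m) ≡⟨ toℕ-fromℕ< b<m ⟩
    b                ∎
    where
    open ≡-Reasoning
    f-a≡f-b : toℕ (f (fromℕ< a<m)) ≡ toℕ (f (fromℕ< b<m))
    f-a≡f-b = trans (h-fromℕ< a<m) (trans ha≡hb (sym (h-fromℕ< b<m)))

  noValley⇒avoids213 : NoValleyOn m h → Avoids f pattern213
  noValley⇒avoids213 noValley occ with contains⇒chain f pattern213ᵖ occ
  ... | c , c₀<c₁ , c₁<c₂ , v₁<v₀ , v₀<v₂ =
    noValley c₀<c₁ c₁<c₂ (toℕ<n (c (# 2))) (<⇒h< v₁<v₀) (<⇒h< (Finₚ.<-trans v₁<v₀ v₀<v₂))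

  noValley⇒avoids312 : NoValleyOn m h → Avoids f pattern312
  noValley⇒avoids312 noValley occ with contains⇒chain f pattern312ᵖ occ
  ... | c , c₀<c₁ , c₁<c₂ , v₁<v₂ , v₂<v₀ =
    noValley c₀<c₁ c₁<c₂ (toℕ<n (c (# 2))) (<⇒h< (Finₚ.<-trans v₁<v₂ v₂<v₀)) (<⇒h< v₁<v₂)

  no132⇒avoids132 : No132On m h → Avoids f pattern132
  no132⇒avoids132 no132 occ with contains⇒chain f pattern132ᵖ occ
  ... | c , c₀<c₁ , c₁<c₂ , v₀<v₂ , v₂<v₁ =
    no132 c₀<c₁ c₁<c₂ (toℕ<n (c (# 2))) (<⇒h< v₀<v₂) (<⇒h< v₂<v₁)

  avoids⇒noValley : Injective _≡_ _≡_ f → Avoids f pattern213 → Avoids f pattern312 → NoValleyOn m h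
  avoids⇒noValley f-inj avoids213 avoids312 {a} {b} {c} a<b b<c c<m hb<ha hb<hc =
    compare (<-cmp (h a) (h c))
    where
    b<m = <-trans b<c c<m
    a<m = <-trans a<b b<m
    pa<pb = fromℕ<-mono a<m b<m a<b
    pb<pc = fromℕ<-mono b<m c<m b<c
    compare : Tri (h a < h c) (h a ≡ h c) (h c < h a) → ⊥
    compare (tri< ha<hc _ _) = avoids213 (chain⇒contains f pattern213ᵖ (positions a<m b<m c<m)
      (pa<pb , pb<pc , h<⇒< b<m a<m hb<ha , h<⇒< a<m c<m ha<hc))
    compare (tri≈ _ ha≡hc _) = <-irrefl (tracked-injective f-inj a<m c<m ha≡hc) (<-trans a<b b<c)
    compare (tri> _ _ hc<ha) = avoids312 (chain⇒contains f pattern312ᵖ (positions a<m b<m c<m)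
      (pa<pb , pb<pc , h<⇒< b<m c<m hb<hc , h<⇒< c<m a<m hc<ha))

  avoids132⇒no132 : Avoids f pattern132 → No132On m h
  avoids132⇒no132 avoids132 {a} {b} {c} a<b b<c c<m ha<hc hc<hb =
    avoids132 (chain⇒contains f pattern132ᵖ (positions a<m b<m c<m)
      (fromℕ<-mono a<m b<m a<b , fromℕ<-mono b<m c<m b<c , h<⇒< a<m c<m ha<hc , h<⇒< c<m b<m hc<hb))
    where
    b<m = <-trans b<c c<m
    a<m = <-trans a<b b<m

tentPerm-avoidsAll : ∀ {m} (k : Fin m) → AvoidsAll (tentPerm k ⟨$⟩ʳ_)
tentPerm-avoidsAll {m} k =
  no132⇒avoids132 tent-no132 , noValley⇒avoids213 tent-noValley , noValley⇒avoids312 tent-noValley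
  where open Tracked {h = tent m (toℕ k)} (toℕ-tentPerm k)

toℕ-view : ∀ {m} → (Fin m → Fin m) → ℕ → ℕ
toℕ-view {m} f a with a <? m
... | yes a<m = toℕ (f (fromℕ< a<m))
... | no  _   = 0

toℕ-view-tracks : ∀ {m} (f : Fin m → Fin m) i → toℕ (f i) ≡ toℕ-view f (toℕ i)
toℕ-view-tracks {m} f i with toℕ i <? m
... | yes i<m = cong (toℕ ∘ f) (sym (fromℕ<-toℕ i i<m))
... | no  i≮m = contradiction (toℕ<n i) i≮m

avoidsAll⇒tentPerm : ∀ {n} {f : Fin (suc n) → Fin (suc n)} → Injective _≡_ _≡_ f → AvoidsAll f →
                     ∀ i → f i ≡ tentPerm (f zero) ⟨$⟩ʳ i
avoidsAll⇒tentPerm {n} {f} f-inj (avoids132 , avoids213 , avoids312) i = toℕ-injective (begin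
  toℕ (f i)                           ≡⟨ tracks i ⟩
  h (toℕ i)                           ≡⟨ ValleyAnd132Free.h≡tent tracked-bounded (tracked-injective f-inj)
                                           (avoids⇒noValley f-inj avoids213 avoids312)
                                           (avoids132⇒no132 avoids132) (toℕ<n i) ⟩
  tent (suc n) (h 0) (toℕ i)          ≡⟨ cong (λ k → tent (suc n) k (toℕ i)) (tracks zero) ⟨
  tent (suc n) (toℕ (f zero)) (toℕ i) ≡⟨ toℕ-tentPerm (f zero) i ⟨
  toℕ (tentPerm (f zero) ⟨$⟩ʳ i)      ∎)
  where
  open ≡-Reasoning
  h = toℕ-view f
  tracks = toℕ-view-tracks f
  open Tracked {h = h} tracks

avoidsAll-resp-≗ : ∀ {m} {f g : Fin m → Fin m} → f ≗ g → AvoidsAll g → AvoidsAll f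
avoidsAll-resp-≗ {f = f} {g} f≗g (avoids132 , avoids213 , avoids312) =
  avoids132 ∘ transport , avoids213 ∘ transport , avoids312 ∘ transport
  where
  transport : ∀ {k} {π : Fin k → Fin k} → Contains f π → Contains g π
  transport {π = π} (c , c↑ , iso) =
    c , c↑ , λ i j → subst₂ (λ x y → (x Fin.< y) ⇔ (π i Fin.< π j)) (f≗g (c i)) (f≗g (c j)) (iso i j)

-- Counting S²ₙ(132, 213, 312)

hasCard-of-parametrisation : ∀ {m} {A : Set} {P : ThreePerm m → Set} (f : A → ThreePerm m) (I : List A) →
  (∀ {x y} → f x ≈₃ f y → x ≡ y) → AllPairs _≢_ I → All (P ∘ f) I →
  (∀ s → P s → Σ A λ x → x ∈ I × s ≈₃ f x) → HasCard P (length I)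
hasCard-of-parametrisation f I f-injective unique I⊆P complete =
  map f I ,
  length-map f I ,
  AllPairsₚ.map⁺ (AllPairs.map (λ x≢y → x≢y ∘ f-injective) unique) ,
  Allₚ.map⁺ I⊆P ,
  λ s s∈P → let x , x∈I , s≈fx = complete s s∈P in Anyₚ.map⁺ (Any.map (λ { refl → s≈fx }) x∈I)

avoidsAll⇒∈S₂ : ∀ {m} {σ σ′ : Permutation′ m} →
                AvoidsAll (σ ⟨$⟩ʳ_) → AvoidsAll (σ′ ⟨$⟩ʳ_) → AvoidsAll ((flip σ ∘ₚ σ′) ⟨$⟩ʳ_) →
                InS2-132-213-312 m (σ , σ′)
avoidsAll⇒∈S₂ (a₁ , a₂ , a₃) (b₁ , b₂ , b₃) (c₁ , c₂ , c₃) =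
  (a₁ , b₁ , c₁) , (a₂ , b₂ , c₂) , (a₃ , b₃ , c₃)

∈S₂⇒avoidsAll : ∀ {m} {σ σ′ : Permutation′ m} → InS2-132-213-312 m (σ , σ′) →
                AvoidsAll (σ ⟨$⟩ʳ_) × AvoidsAll (σ′ ⟨$⟩ʳ_) × AvoidsAll ((flip σ ∘ₚ σ′) ⟨$⟩ʳ_)
∈S₂⇒avoidsAll ((a₁ , b₁ , c₁) , (a₂ , b₂ , c₂) , (a₃ , b₃ , c₃)) =
  (a₁ , a₂ , a₃) , (b₁ , b₂ , b₃) , (c₁ , c₂ , c₃)

tentPerm-at-0 : ∀ {n} (k : Fin (suc n)) → tentPerm k ⟨$⟩ʳ zero ≡ k
tentPerm-at-0 k = toℕ-injective (trans (toℕ-tentPerm k zero) (tent-at-0 (toℕ<n k)))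

tentPerm-injective : ∀ {n} {k l : Fin (suc n)} → tentPerm k ≈ tentPerm l → k ≡ l
tentPerm-injective {k = k} {l} τk≈τl =
  trans (sym (tentPerm-at-0 k)) (trans (τk≈τl zero) (tentPerm-at-0 l))

tentPerm-0≈id : ∀ {n} → tentPerm {suc n} zero ≈ id
tentPerm-0≈id i = toℕ-injective (trans (toℕ-tentPerm zero i) (tent-0-id (toℕ<n i)))

tentPerm-at-last : ∀ {n} (k : Fin n) → tentPerm (suc k) ⟨$⟩ʳ fromℕ n ≡ zero
tentPerm-at-last {n} k = toℕ-injective (begin
  toℕ (tentPerm (suc k) ⟨$⟩ʳ fromℕ n)        ≡⟨ toℕ-tentPerm (suc k) (fromℕ n) ⟩
  tent (suc n) (suc (toℕ k)) (toℕ (fromℕ n)) ≡⟨ cong (tent (suc n) (suc (toℕ k))) (toℕ-fromℕ n) ⟩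
  tent (suc n) (suc (toℕ k)) n               ≡⟨ tent-at-last {n} {suc (toℕ k)} z<s ⟩
  0                                          ∎)
  where open ≡-Reasoning

tentPerm-last≈reverse : ∀ {n} → tentPerm (fromℕ n) ≈ reverse
tentPerm-last≈reverse {n} i = toℕ-injective (begin
  toℕ (tentPerm (fromℕ n) ⟨$⟩ʳ i)      ≡⟨ toℕ-tentPerm (fromℕ n) i ⟩
  tent (suc n) (toℕ (fromℕ n)) (toℕ i) ≡⟨ cong (λ k → tent (suc n) k (toℕ i)) (toℕ-fromℕ n) ⟩
  tent (suc n) n (toℕ i)               ≡⟨ tent-reverse n (toℕ i) ⟩
  n ∸ toℕ i                            ≡⟨ opposite-prop i ⟨
  toℕ (opposite i)                     ∎)
  where open ≡-Reasoning

tentPerm-composition-cases : ∀ {n} {a b c : Fin (suc n)} → tentPerm a ∘ₚ tentPerm c ≈ tentPerm b →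
                             a ≡ zero ⊎ a ≡ b ⊎ (a ≡ fromℕ n × b ≡ zero)
tentPerm-composition-cases {a = zero} _ = inj₁ refl
tentPerm-composition-cases {n} {suc a} {b} {c} τa∘τc≈τb = inj₂ (by-cases-on b c≡τb-last τc-a≡b)
  where
  open ≡-Reasoning
  c≡τb-last : c ≡ tentPerm b ⟨$⟩ʳ fromℕ n
  c≡τb-last = begin
    c                                               ≡⟨ tentPerm-at-0 c ⟨
    tentPerm c ⟨$⟩ʳ zero                            ≡⟨ cong (tentPerm c ⟨$⟩ʳ_) (tentPerm-at-last a) ⟨
    tentPerm c ⟨$⟩ʳ (tentPerm (suc a) ⟨$⟩ʳ fromℕ n) ≡⟨ τa∘τc≈τb (fromℕ n) ⟩
    tentPerm b ⟨$⟩ʳ fromℕ n                         ∎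
  τc-a≡b : tentPerm c ⟨$⟩ʳ suc a ≡ b
  τc-a≡b = begin
    tentPerm c ⟨$⟩ʳ suc a                        ≡⟨ cong (tentPerm c ⟨$⟩ʳ_) (tentPerm-at-0 (suc a)) ⟨
    tentPerm c ⟨$⟩ʳ (tentPerm (suc a) ⟨$⟩ʳ zero) ≡⟨ τa∘τc≈τb zero ⟩
    tentPerm b ⟨$⟩ʳ zero                         ≡⟨ tentPerm-at-0 b ⟩
    b                                            ∎
  by-cases-on : ∀ b → c ≡ tentPerm b ⟨$⟩ʳ fromℕ n → tentPerm c ⟨$⟩ʳ suc a ≡ b →
                suc a ≡ b ⊎ (suc a ≡ fromℕ n × b ≡ zero)
  by-cases-on zero c≡τ₀-last τc-a≡0 = inj₂ (suc-a≡last , refl)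
    where
    suc-a≡last : suc a ≡ fromℕ n
    suc-a≡last = begin
      suc a                            ≡⟨ opposite-involutive (suc a) ⟨
      opposite (opposite (suc a))      ≡⟨ cong opposite (tentPerm-last≈reverse (suc a)) ⟨
      opposite (tentPerm (fromℕ n) ⟨$⟩ʳ suc a)
                                       ≡⟨ cong (λ k → opposite (tentPerm k ⟨$⟩ʳ suc a))
                                            (trans c≡τ₀-last (tentPerm-0≈id (fromℕ n))) ⟨
      opposite (tentPerm c ⟨$⟩ʳ suc a) ≡⟨ cong opposite τc-a≡0 ⟩
      opposite zero                    ∎
  by-cases-on (suc b) c≡τb-last τc-a≡b = inj₁ (begin
    suc a                    ≡⟨ tentPerm-0≈id (suc a) ⟨
    tentPerm zero ⟨$⟩ʳ suc a ≡⟨ cong (λ k → tentPerm k ⟨$⟩ʳ suc a)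
                                  (trans c≡τb-last (tentPerm-at-last b)) ⟨
    tentPerm c ⟨$⟩ʳ suc a    ≡⟨ τc-a≡b ⟩
    suc b                    ∎)

tentPair : ∀ {m} → Fin m × Fin m → ThreePerm m
tentPair (a , b) = tentPerm a , tentPerm b

tentPair-injective : ∀ {n} {p q : Fin (suc n) × Fin (suc n)} → tentPair p ≈₃ tentPair q → p ≡ q
tentPair-injective (τa≈τc , τb≈τd) = cong₂ _,_ (tentPerm-injective τa≈τc) (tentPerm-injective τb≈τd)

tentPair-∈S₂ : ∀ {m} (a b c : Fin m) → flip (tentPerm a) ∘ₚ tentPerm b ≈ tentPerm c →
               InS2-132-213-312 m (tentPair (a , b))
tentPair-∈S₂ a b c τa⁻¹∘τb≈τc = avoidsAll⇒∈S₂ {σ = tentPerm a} {tentPerm b}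
  (tentPerm-avoidsAll a) (tentPerm-avoidsAll b) (avoidsAll-resp-≗ τa⁻¹∘τb≈τc (tentPerm-avoidsAll c))

tentPair-identity-∈S₂ : ∀ {n} (b : Fin (suc n)) → InS2-132-213-312 (suc n) (tentPair (zero , b))
tentPair-identity-∈S₂ b = tentPair-∈S₂ zero b b λ i →
  cong (tentPerm b ⟨$⟩ʳ_) (Inverse.inverseʳ (tentPerm zero) (sym (tentPerm-0≈id i)))

tentPair-equal-∈S₂ : ∀ {n} (a : Fin (suc n)) → InS2-132-213-312 (suc n) (tentPair (a , a))
tentPair-equal-∈S₂ a = tentPair-∈S₂ a a zero λ i → trans (inverseʳ (tentPerm a)) (sym (tentPerm-0≈id i))

tentPair-reverse-∈S₂ : ∀ n → InS2-132-213-312 (suc n) (tentPair (fromℕ n , zero))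
tentPair-reverse-∈S₂ n = tentPair-∈S₂ (fromℕ n) zero (fromℕ n) λ i →
  trans (tentPerm-0≈id _) (Inverse.inverseʳ (tentPerm (fromℕ n)) (sym (involutive i)))
  where
  involutive : ∀ i → tentPerm (fromℕ n) ⟨$⟩ʳ (tentPerm (fromℕ n) ⟨$⟩ʳ i) ≡ i
  involutive i = begin
    tentPerm (fromℕ n) ⟨$⟩ʳ (tentPerm (fromℕ n) ⟨$⟩ʳ i) ≡⟨ tentPerm-last≈reverse _ ⟩
    opposite (tentPerm (fromℕ n) ⟨$⟩ʳ i)               ≡⟨ cong opposite (tentPerm-last≈reverse i) ⟩
    opposite (opposite i)                              ≡⟨ opposite-involutive i ⟩
    i                                                  ∎
    where open ≡-Reasoning

identityPair : ∀ {n} → Fin (suc n) → Fin (suc n) × Fin (suc n)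
identityPair b = zero , b

equalPair : ∀ {n} → Fin n → Fin (suc n) × Fin (suc n)
equalPair a = suc a , suc a

identityPairs : ∀ n → List (Fin (suc n) × Fin (suc n))
identityPairs n = tabulate identityPair

equalPairs : ∀ n → List (Fin (suc n) × Fin (suc n))
equalPairs n = tabulate equalPair

tentIndices : ∀ n → List (Fin (suc n) × Fin (suc n))
tentIndices zero    = identityPairs zero
tentIndices (suc n) = identityPairs (suc n) ++ equalPairs (suc n) ++ (fromℕ (suc n) , zero) ∷ []

tentIndices-length : ∀ n → length (tentIndices (suc n)) ≡ 2 * suc (suc n)
tentIndices-length n = begin
  length (tentIndices (suc n))
    ≡⟨ length-++ (identityPairs (suc n)) ⟩
  length (identityPairs (suc n)) + length (equalPairs (suc n) ++ (fromℕ (suc n) , zero) ∷ [])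
    ≡⟨ cong₂ _+_ (length-tabulate (identityPair {suc n}))
         (trans (length-++ (equalPairs (suc n))) (cong (_+ 1) (length-tabulate (equalPair {suc n})))) ⟩
  suc (suc n) + (suc n + 1)
    ≡⟨ count n ⟩
  2 * suc (suc n)
    ∎
  where
  open ≡-Reasoning
  count : ∀ n → suc (suc n) + (suc n + 1) ≡ 2 * suc (suc n)
  count = solve-∀

tentIndices-unique : ∀ n → AllPairs _≢_ (tentIndices n)
tentIndices-unique zero    = [] ∷ []
tentIndices-unique (suc n) =
  AllPairsₚ.++⁺ (AllPairsₚ.tabulate⁺ {f = identityPair} λ i≢j → i≢j ∘ cong proj₂)
    (AllPairsₚ.++⁺ (AllPairsₚ.tabulate⁺ {f = equalPair} λ i≢j → i≢j ∘ Finₚ.suc-injective ∘ cong proj₁)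
      ([] ∷ [])
      (Allₚ.tabulate⁺ {f = equalPair} λ _ → (λ ()) ∷ []))
    (Allₚ.tabulate⁺ {f = identityPair} λ _ →
      Allₚ.++⁺ (Allₚ.tabulate⁺ {f = equalPair} λ _ ()) ((λ ()) ∷ []))

tentIndices⊆S₂ : ∀ n → All (InS2-132-213-312 (suc n) ∘ tentPair) (tentIndices n)
tentIndices⊆S₂ zero    = tentPair-identity-∈S₂ zero ∷ []
tentIndices⊆S₂ (suc n) =
  Allₚ.++⁺ (Allₚ.tabulate⁺ {f = identityPair} tentPair-identity-∈S₂)
    (Allₚ.++⁺ (Allₚ.tabulate⁺ {f = equalPair} (tentPair-equal-∈S₂ ∘ suc))
      (tentPair-reverse-∈S₂ (suc n) ∷ []))

tentIndices-complete : ∀ {n} {a b : Fin (suc n)} → a ≡ zero ⊎ a ≡ b ⊎ (a ≡ fromℕ n × b ≡ zero) →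
                       (a , b) ∈ tentIndices n
tentIndices-complete {zero}  {zero} {zero} _ = here refl
tentIndices-complete {suc n} {zero} {b}    _ = ∈-++⁺ˡ (∈-tabulate⁺ {f = identityPair} b)
tentIndices-complete {suc n} {suc a} (inj₂ (inj₁ refl)) =
  ∈-++⁺ʳ (identityPairs (suc n)) (∈-++⁺ˡ (∈-tabulate⁺ {f = equalPair} a))
tentIndices-complete {suc n} {suc a} (inj₂ (inj₂ (refl , refl))) =
  ∈-++⁺ʳ (identityPairs (suc n)) (∈-++⁺ʳ (equalPairs (suc n)) (here refl))

∈S₂⇒tentPair : ∀ {n} s → InS2-132-213-312 (suc n) s →
               Σ (Fin (suc n) × Fin (suc n)) λ p → p ∈ tentIndices n × s ≈₃ tentPair p
∈S₂⇒tentPair {n} (σ , σ′) σσ′∈S₂ with ∈S₂⇒avoidsAll {σ = σ} {σ′} σσ′∈S₂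
... | avoidsσ , avoidsσ′ , avoidsρ =
  (a , b) , tentIndices-complete (tentPerm-composition-cases {a = a} {b} {c} τa∘τc≈τb) , σ≈τa , σ′≈τb
  where
  ρ : Permutation′ (suc n)
  ρ = flip σ ∘ₚ σ′
  a b c : Fin (suc n)
  a = σ ⟨$⟩ʳ zero
  b = σ′ ⟨$⟩ʳ zero
  c = ρ ⟨$⟩ʳ zero
  σ≈τa : σ ≈ tentPerm a
  σ≈τa = avoidsAll⇒tentPerm (Injection.injective (↔⇒↣ σ)) avoidsσ
  σ′≈τb : σ′ ≈ tentPerm b
  σ′≈τb = avoidsAll⇒tentPerm (Injection.injective (↔⇒↣ σ′)) avoidsσ′
  ρ≈τc : ρ ≈ tentPerm c
  ρ≈τc = avoidsAll⇒tentPerm (Injection.injective (↔⇒↣ ρ)) avoidsρ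
  τa∘τc≈τb : tentPerm a ∘ₚ tentPerm c ≈ tentPerm b
  τa∘τc≈τb i = begin
    tentPerm c ⟨$⟩ʳ (tentPerm a ⟨$⟩ʳ i) ≡⟨ cong (tentPerm c ⟨$⟩ʳ_) (σ≈τa i) ⟨
    tentPerm c ⟨$⟩ʳ (σ ⟨$⟩ʳ i)          ≡⟨ ρ≈τc (σ ⟨$⟩ʳ i) ⟨
    σ′ ⟨$⟩ʳ (σ ⟨$⟩ˡ (σ ⟨$⟩ʳ i))         ≡⟨ cong (σ′ ⟨$⟩ʳ_) (inverseˡ σ) ⟩
    σ′ ⟨$⟩ʳ i                           ≡⟨ σ′≈τb i ⟩
    tentPerm b ⟨$⟩ʳ i                   ∎
    where open ≡-Reasoning

S₂-hasCard : ∀ n → HasCard (InS2-132-213-312 (suc n)) (length (tentIndices n))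
S₂-hasCard n = hasCard-of-parametrisation tentPair (tentIndices n) tentPair-injective
  (tentIndices-unique n) (tentIndices⊆S₂ n) ∈S₂⇒tentPair

theorem4p1 : HasCard (InS2-132-213-312 1) 1 ×
    (∀ (n : ℕ) → 1 ≤ n → HasCard (InS2-132-213-312 (suc n)) (2 * suc n))
theorem4p1 = S₂-hasCard 0 , λ where
  (suc n) _ → subst (HasCard (InS2-132-213-312 (suc (suc n)))) (tentIndices-length n)
                (S₂-hasCard (suc n))
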